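{- Let $q\ge 2$ and $n\ge 1$ be integers, and let $S=(s_i)$ be an orientable sequence of order $n$ over $\mathbb{Z}_q$ with period $m$. Let $h$ be the additive order of $w_q(S)$ in $\mathbb{Z}_q$. Then there are $q/h$ sequences $T_1,\dots,T_{q/h}$, each a negative orientable sequence of order $n+1$ with period $hm$, which are translates of one another and pairwise no-disjoint, such that $D^{ -1}(S)$ consists exactly of the $h$ shifts $(t_{i+km})_i$, $0\le k\le h-1$, of each $T_\ell=(t_i)$.
   Context: Sequences are periodic with entries in $\mathbb{Z}_q$; the period means the least period. For $S=(s_i)$ of period $m$, $\mathbf{s}_n(i)=(s_i,\dots,s_{i+n-1})$; the ring sequence is $[s_0,\dots,s_{m-1}]$ and $w_q(S)=\sum_{i=0}^{m-1}s_i \bmod q$. For a tuple $\mathbf{u}=(u_0,\dots,u_{n-1})$, $\mathbf{u}^R=(u_{n-1},\dots,u_0)$ and $-\mathbf{u}=(-u_0,\dots,-u_{n-1})$. $S$ is an $n$-window sequence if $\mathbf{s}_n(i)=\mathbf{s}_n(j)$ implies $i\equiv j\pmod m$. An orientable sequence of order $n$ is an $n$-window sequence with $\mathbf{s}_n(i)\neq\mathbf{s}_n(j)^R$ for all $i,j$; a negative orientable sequence of order $n$ is an $n$-window sequence with $\mathbf{s}_n(i)\neq-\mathbf{s}_n(j)^R$ for all $i,j$. Two $n$-window sequences $S,S'$ are disjoint if $\mathbf{s}_n(i)\neq\mathbf{s}'_n(j)$ for all $i,j$, and no-disjoint if they are disjoint and $\mathbf{s}_n(i)\neq-\mathbf{s}'_n(j)^R$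 for all $i,j$. A translate of $(t_i)$ is $(t_i+\lambda)$ for some nonzero $\lambda\in\mathbb{Z}_q$; a shift is $(t_{i+k})$. $D$ maps a periodic sequence $(t_i)$ to $(t_{i+1}-t_i)$, and $D^{ -1}(S)$ is the set of all periodic sequences $T$ with $D(T)=S$. -}

module Defs where

open import Data.Nat using (ℕ; zero; suc; _+_; _*_; _∸_; _≤_; _<_)
open import Data.Nat.DivMod using (_mod_)
open import Data.Fin using (Fin; toℕ)
open import Data.Vec using (Vec; tabulate; reverse; map)
open import Data.Product using (_×_; ∃)
open import Relation.Binary.PropositionalEquality using (_≡_; _≢_)

-- Arithmetic in ℤ_q, represented by Fin q (residues 0 … q-1).
-- (Fin 0 is empty, so the q = 0 clauses are vacuous placeholders.)
_+q_ : ∀ {q} → Fin q → Fin q → Fin q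
_+q_ {suc q} a b = (toℕ a + toℕ b) mod suc q

-q_ : ∀ {q} → Fin q → Fin q
-q_ {suc q} a = (suc q ∸ toℕ a) mod suc q

_-q_ : ∀ {q} → Fin q → Fin q → Fin q
a -q b = a +q (-q b)

_·q_ : ∀ {q} → ℕ → Fin q → Fin q
_·q_ {suc q} k a = (k * toℕ a) mod suc q

Seq : ℕ → Set
Seq q = ℕ → Fin q

HasPeriod : ∀ {q} → Seq q → ℕ → Set
HasPeriod s p = ∀ i → s (i + p) ≡ s i

Periodic : ∀ {q} → Seq q → Set
Periodic s = ∃ λ p → 0 < p × HasPeriod s p

LeastPeriod : ∀ {q} → Seq q → ℕ → Set
LeastPeriod s m = 0 < m × HasPeriod s m × (∀ k → 0 < k → HasPeriod s k → m ≤ k)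

_≡_[mod_] : ℕ → ℕ → ℕ → Set
i ≡ j [mod m ] = ∃ λ a → ∃ λ b → i + a * m ≡ j + b * m

window : ∀ {q} → (n : ℕ) → Seq q → ℕ → Vec (Fin q) n
window n s i = tabulate (λ j → s (i + toℕ j))

negRev : ∀ {q n} → Vec (Fin q) n → Vec (Fin q) n
negRev u = map -q_ (reverse u)

NWindow : ∀ {q} → ℕ → Seq q → Set
NWindow n s = ∀ m → LeastPeriod s m →
  ∀ i j → window n s i ≡ window n s j → i ≡ j [mod m ]

Orientable : ∀ {q} → ℕ → Seq q → Set
Orientable n s = NWindow n s × (∀ i j → window n s i ≢ reverse (window n s j))

NegOrientable : ∀ {q} → ℕ → Seq q → Set
NegOrientable n s = NWindow n s × (∀ i j → window n s i ≢ negRev (window n s j))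

Disjoint : ∀ {q} → ℕ → Seq q → Seq q → Set
Disjoint n s s′ = ∀ i j → window n s i ≢ window n s′ j

NoDisjoint : ∀ {q} → ℕ → Seq q → Seq q → Set
NoDisjoint n s s′ = Disjoint n s s′ × (∀ i j → window n s i ≢ negRev (window n s′ j))

wq : ∀ {q} → Seq q → ℕ → Fin q
wq s zero = 0 ·q s 0
wq s (suc m) = wq s m +q s m

AddOrder : ∀ {q} → Fin q → ℕ → Set
AddOrder a h = 0 < h × toℕ (h ·q a) ≡ 0 × (∀ k → 0 < k → toℕ (k ·q a) ≡ 0 → h ≤ k)

Translate : ∀ {q} → Seq q → Seq q → Set
Translate t u = ∃ λ c → toℕ c ≢ 0 × (∀ i → t i ≡ u i +q c)

DEq : ∀ {q} → Seq q → Seq q → Set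
DEq t s = ∀ i → t (suc i) -q t i ≡ s i

InDInv : ∀ {q} → Seq q → Seq q → Set
InDInv t s = Periodic t × DEq t s

-- If D(T) = S then t_i = t_0 + ψ_i, where ψ = wq s is the partial-sum sequence of S, so D⁻¹(S)
-- consists of the translates c + ψ. Periodicity of S gives ψ_{i+km} = ψ_i + k·w for w = w_q(S):
-- shifting a lift by km translates it by k·w. Hence each lift has least period hm, and the lifts up
-- to shift correspond to the cosets of the order-h subgroup ⟨w⟩, represented by the residues ℓ < q/h.
-- Applying D, equal (n+1)-windows of lifts give equal n-windows of S, and an (n+1)-window equal to a
-- negated reversed one gives an n-window equal to a reversed one, so orientability of S yields
-- negative orientability and no-disjointness of the lifts.

module Submission where

open import Defs
open import Data.Nat using (ℕ; zero; suc; _+_; _*_; _∸_; _≤_; _<_; _%_; _/_; NonZero; >-nonZero; >-nonZero⁻¹; z<s; s<s)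
open import Data.Nat.Properties hiding (_≟_)
open import Data.Nat.DivMod
open import Data.Nat.Divisibility using (_∣_; divides; m%n≡0⇒n∣m; ∣n⇒∣m*n; ∣⇒≤; *-cancelʳ-∣; %-presˡ-∣)
open import Data.Nat.Tactic.RingSolver using (solve-∀)
open import Data.Fin using (Fin; toℕ; fromℕ<; fromℕ; inject₁; punchOut; combine; remQuot)
open import Data.Fin.Properties using (_≟_; toℕ-fromℕ<; toℕ-injective; toℕ<n; toℕ-inject₁; toℕ-fromℕ; any?; pigeonhole; punchOut-injective; combine-remQuot)
open import Data.Fin.Patterns using (0F)
open import Data.Vec using (tabulate; reverse; map; lookup; _∷ʳ_; _∷_)
open import Data.Vec.Properties using (lookup∘tabulate; tabulate-cong; tabulate-∘; reverse-∷)
open import Data.Product using (_×_; ∃; ∃₂; _,_; proj₁; proj₂; uncurry)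
open import Data.Sum using (inj₁; inj₂)
open import Algebra.Bundles using (AbelianGroup)
open import Algebra.Structures using (IsAbelianGroup)
open import Function using (_∘_)
open import Function.Bundles using (_⇔_; mk⇔)
open import Function.Definitions using (Injective; StrictlySurjective)
open import Level using (0ℓ)
open import Relation.Nullary using (yes; no; contradiction)
open import Relation.Binary.PropositionalEquality

open ≡-Reasoning

least-positive-∣ : ∀ {P : ℕ → Set} {h k} .{{_ : NonZero h}} →
                   (∀ j → 0 < j → P j → h ≤ j) → P (k % h) → h ∣ k
least-positive-∣ {P} {h} {k} least P[k%h] = m%n≡0⇒n∣m k h (below-least (k % h) (m%n<n k h) P[k%h])
  where
  below-least : ∀ j → j < h → P j → j ≡ 0
  below-least zero    _   _  = refl
  below-least (suc j) j<h Pj = contradiction (least (suc j) z<s Pj) (<⇒≱ j<h)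

≡[mod]-sym : ∀ {i j m} → i ≡ j [mod m ] → j ≡ i [mod m ]
≡[mod]-sym (a , b , e) = b , a , sym e

∣∸⇒≡[mod] : ∀ {a b h} → a ≤ b → h ∣ b ∸ a → a ≡ b [mod h ]
∣∸⇒≡[mod] {a} {b} {h} a≤b (divides c b∸a≡c*h) = c , 0 , (begin
  a + c * h    ≡⟨ cong (a +_) b∸a≡c*h ⟨
  a + (b ∸ a)  ≡⟨ m+[n∸m]≡n a≤b ⟩
  b            ≡⟨ +-identityʳ b ⟨
  b + 0 * h    ∎)

≡[mod]∧<⇒≡ : ∀ {a b h} .{{_ : NonZero h}} → a ≡ b [mod h ] → a < h → b < h → a ≡ b
≡[mod]∧<⇒≡ {a} {b} {h} (c , d , a+ch≡b+dh) a<h b<h = begin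
  a                ≡⟨ m<n⇒m%n≡m a<h ⟨
  a % h            ≡⟨ [m+kn]%n≡m%n a c h ⟨
  (a + c * h) % h  ≡⟨ cong (_% h) a+ch≡b+dh ⟩
  (b + d * h) % h  ≡⟨ [m+kn]%n≡m%n b d h ⟩
  b % h            ≡⟨ m<n⇒m%n≡m b<h ⟩
  b                ∎

≡[mod]-scale : ∀ {i j a b m h} → i + a * m ≡ j + b * m → a ≡ b [mod h ] → i ≡ j [mod h * m ]
≡[mod]-scale {i} {j} {a} {b} {m} {h} i+am≡j+bm (c , d , a+ch≡b+dh) =
  d , c , +-cancelʳ-≡ (a * m) _ _ (begin
    i + d * (h * m) + a * m  ≡⟨ swap i a d h m ⟨
    i + a * m + d * h * m    ≡⟨ cong (_+ d * h * m) i+am≡j+bm ⟩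
    j + b * m + d * h * m    ≡⟨ collect j b (d * h) m ⟩
    j + (b + d * h) * m      ≡⟨ cong (λ x → j + x * m) a+ch≡b+dh ⟨
    j + (a + c * h) * m      ≡⟨ collect j a (c * h) m ⟨
    j + a * m + c * h * m    ≡⟨ swap j a c h m ⟩
    j + c * (h * m) + a * m  ∎)
  where
  swap : ∀ x y z h m → x + y * m + z * h * m ≡ x + z * (h * m) + y * m
  swap = solve-∀
  collect : ∀ x y z m → x + y * m + z * m ≡ x + (y + z) * m
  collect = solve-∀

injective⇒strictlySurjective : ∀ {m n} {f : Fin m → Fin n} → m ≡ n →
                               Injective _≡_ _≡_ f → StrictlySurjective _≡_ f
injective⇒strictlySurjective {suc n} {f = f} refl f-inj y with any? (λ x → f x ≟ y)
... | yes hit = hit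
... | no miss =
  let i , j , i<j , gi≡gj = pigeonhole ≤-refl g
  in contradiction (cong toℕ (f-inj (punchOut-injective y≢f y≢f gi≡gj))) (<⇒≢ i<j)
  where
  y≢f : ∀ {x} → y ≢ f x
  y≢f {x} y≡fx = miss (x , sym y≡fx)
  g : Fin (suc n) → Fin n
  g x = punchOut (y≢f {x})

module _ {A : Set} where

  tabulate-∷ʳ : ∀ n (g : Fin (suc n) → A) → tabulate g ≡ tabulate (g ∘ inject₁) ∷ʳ g (fromℕ n)
  tabulate-∷ʳ zero    g = refl
  tabulate-∷ʳ (suc n) g = cong (g 0F ∷_) (tabulate-∷ʳ n (g ∘ Fin.suc))

  reverse-tabulate : ∀ n (f : ℕ → A) →
                     reverse (tabulate {n = n} (f ∘ toℕ)) ≡ tabulate (λ k → f (n ∸ suc (toℕ k)))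
  reverse-tabulate zero    f = refl
  reverse-tabulate (suc n) f = begin
    reverse (f 0 ∷ tabulate (f ∘ suc ∘ toℕ))                            ≡⟨ reverse-∷ (f 0) (tabulate (f ∘ suc ∘ toℕ)) ⟩
    reverse (tabulate (f ∘ suc ∘ toℕ)) ∷ʳ f 0                          ≡⟨ cong (_∷ʳ f 0) (reverse-tabulate n (f ∘ suc)) ⟩
    tabulate (λ k → f (suc (n ∸ suc (toℕ k)))) ∷ʳ f 0                  ≡⟨ cong₂ _∷ʳ_ (tabulate-cong (cong f ∘ inner)) (cong f last) ⟩
    tabulate (λ k → f (n ∸ toℕ (inject₁ k))) ∷ʳ f (n ∸ toℕ (fromℕ n))  ≡⟨ tabulate-∷ʳ n (λ k → f (n ∸ toℕ k)) ⟨
    tabulate (λ k → f (n ∸ toℕ k))                                      ∎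
    where
    inner : ∀ (k : Fin n) → suc (n ∸ suc (toℕ k)) ≡ n ∸ toℕ (inject₁ k)
    inner k = trans (sym (+-∸-assoc 1 (toℕ<n k))) (cong (n ∸_) (sym (toℕ-inject₁ k)))
    last : 0 ≡ n ∸ toℕ (fromℕ n)
    last = trans (sym (n∸n≡0 n)) (cong (n ∸_) (sym (toℕ-fromℕ n)))

  tabulate-toℕ-≡⇒ : ∀ {n} (f g : ℕ → A) → tabulate {n = n} (f ∘ toℕ) ≡ tabulate (g ∘ toℕ) →
                    ∀ {x} → x < n → f x ≡ g x
  tabulate-toℕ-≡⇒ f g e {x} x<n = begin
    f x                            ≡⟨ cong f (toℕ-fromℕ< x<n) ⟨
    f (toℕ k)                      ≡⟨ lookup∘tabulate (f ∘ toℕ) k ⟨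
    lookup (tabulate (f ∘ toℕ)) k  ≡⟨ cong (λ v → lookup v k) e ⟩
    lookup (tabulate (g ∘ toℕ)) k  ≡⟨ lookup∘tabulate (g ∘ toℕ) k ⟩
    g (toℕ k)                      ≡⟨ cong g (toℕ-fromℕ< x<n) ⟩
    g x                            ∎
    where
    k = fromℕ< x<n

module _ {q n : ℕ} (f g : Seq q) (i j : ℕ) where

  window-≡⇒ : window n f i ≡ window n g j → ∀ {x} → x < n → f (i + x) ≡ g (j + x)
  window-≡⇒ = tabulate-toℕ-≡⇒ (λ x → f (i + x)) (λ x → g (j + x))

  window-≡-negRev⇒ : window n f i ≡ negRev (window n g j) →
                     ∀ {x} → x < n → f (i + x) ≡ -q g (j + (n ∸ suc x))
  window-≡-negRev⇒ e = tabulate-toℕ-≡⇒ (λ x → f (i + x)) (λ x → -q g (j + (n ∸ suc x))) (begin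
    window n f i                                                   ≡⟨ e ⟩
    map (λ a → -q a) (reverse (window n g j))                      ≡⟨ cong (map (λ a → -q a)) (reverse-tabulate n (λ x → g (j + x))) ⟩
    map (λ a → -q a) (tabulate (λ k → g (j + (n ∸ suc (toℕ k)))))  ≡⟨ tabulate-∘ (λ a → -q a) _ ⟨
    tabulate (λ k → -q g (j + (n ∸ suc (toℕ k))))                  ∎)

  window-≡⇐ : (∀ {x} → x < n → f (i + x) ≡ g (j + x)) → window n f i ≡ window n g j
  window-≡⇐ f≡g = tabulate-cong (λ k → f≡g (toℕ<n k))

  window-≡-reverse⇐ : (∀ {x} → x < n → f (i + x) ≡ g (j + (n ∸ suc x))) →
                      window n f i ≡ reverse (window n g j)
  window-≡-reverse⇐ f≡g = trans (tabulate-cong (λ k → f≡g (toℕ<n k))) (sym (reverse-tabulate n (λ x → g (j + x))))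

module _ {q : ℕ} {s : Seq q} where

  hasPeriod-* : ∀ {m} → HasPeriod s m → ∀ k → HasPeriod s (k * m)
  hasPeriod-* per zero    i = cong s (+-identityʳ i)
  hasPeriod-* {m} per (suc k) i = begin
    s (i + (m + k * m))  ≡⟨ cong s (+-assoc i m (k * m)) ⟨
    s (i + m + k * m)    ≡⟨ hasPeriod-* per k (i + m) ⟩
    s (i + m)            ≡⟨ per i ⟩
    s i                  ∎

  leastPeriod-∣ : ∀ {m k} → LeastPeriod s m → HasPeriod s k → m ∣ k
  leastPeriod-∣ {m} {k} (m>0 , perₘ , least) perₖ = least-positive-∣ least per[k%m]
    where
    instance
      m≢0 : NonZero m
      m≢0 = >-nonZero m>0
    per[k%m] : HasPeriod s (k % m)
    per[k%m] i = begin
      s (i + k % m)                ≡⟨ hasPeriod-* perₘ (k / m) (i + k % m) ⟨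
      s (i + k % m + k / m * m)    ≡⟨ cong s (+-assoc i (k % m) (k / m * m)) ⟩
      s (i + (k % m + k / m * m))  ≡⟨ cong (λ x → s (i + x)) (m≡m%n+[m/n]*n k m) ⟨
      s (i + k)                    ≡⟨ perₖ i ⟩
      s i                          ∎

  leastPeriod-unique : ∀ {m m′} → LeastPeriod s m → LeastPeriod s m′ → m ≡ m′
  leastPeriod-unique (m>0 , perₘ , leastₘ) (m′>0 , perₘ′ , leastₘ′) =
    ≤-antisym (leastₘ _ m′>0 perₘ′) (leastₘ′ _ m>0 perₘ)

module ZMod (p : ℕ) where

  Q : ℕ
  Q = suc p

  toℕ-mod : ∀ x → toℕ (x mod Q) ≡ x % Q
  toℕ-mod x = toℕ-fromℕ< (m%n<n x Q)

  mod-cong : ∀ x y → x % Q ≡ y % Q → x mod Q ≡ y mod Q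
  mod-cong x y eq = toℕ-injective (begin
    toℕ (x mod Q) ≡⟨ toℕ-mod x ⟩
    x % Q         ≡⟨ eq ⟩
    y % Q         ≡⟨ toℕ-mod y ⟨
    toℕ (y mod Q) ∎)

  toℕ-+q : ∀ (a b : Fin Q) → toℕ (a +q b) ≡ (toℕ a + toℕ b) % Q
  toℕ-+q a b = toℕ-mod (toℕ a + toℕ b)

  toℕ-mod-id : ∀ (a : Fin Q) → toℕ a mod Q ≡ a
  toℕ-mod-id a = toℕ-injective (trans (toℕ-mod (toℕ a)) (m<n⇒m%n≡m (toℕ<n a)))

  mod-homo-+ : ∀ x y → (x mod Q) +q (y mod Q) ≡ (x + y) mod Q
  mod-homo-+ x y = mod-cong (toℕ (x mod Q) + toℕ (y mod Q)) (x + y) (begin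
    (toℕ (x mod Q) + toℕ (y mod Q)) % Q ≡⟨ cong₂ (λ u v → (u + v) % Q) (toℕ-mod x) (toℕ-mod y) ⟩
    (x % Q + y % Q) % Q                 ≡⟨ %-distribˡ-+ x y Q ⟨
    (x + y) % Q                         ∎)

  +q-comm : ∀ (a b : Fin Q) → a +q b ≡ b +q a
  +q-comm a b = cong (_mod Q) (+-comm (toℕ a) (toℕ b))

  +q-assoc : ∀ (a b c : Fin Q) → (a +q b) +q c ≡ a +q (b +q c)
  +q-assoc a b c = begin
    (a +q b) +q c                             ≡⟨ cong ((a +q b) +q_) (toℕ-mod-id c) ⟨
    ((toℕ a + toℕ b) mod Q) +q (toℕ c mod Q)  ≡⟨ mod-homo-+ (toℕ a + toℕ b) (toℕ c) ⟩
    (toℕ a + toℕ b + toℕ c) mod Q             ≡⟨ cong (_mod Q) (+-assoc (toℕ a) (toℕ b) (toℕ c)) ⟩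
    (toℕ a + (toℕ b + toℕ c)) mod Q           ≡⟨ mod-homo-+ (toℕ a) (toℕ b + toℕ c) ⟨
    (toℕ a mod Q) +q (b +q c)                 ≡⟨ cong (_+q (b +q c)) (toℕ-mod-id a) ⟩
    a +q (b +q c)                             ∎

  +q-identityˡ : ∀ (a : Fin Q) → 0F +q a ≡ a
  +q-identityˡ = toℕ-mod-id

  +q-identityʳ : ∀ (a : Fin Q) → a +q 0F ≡ a
  +q-identityʳ a = trans (+q-comm a _) (+q-identityˡ a)

  -q-inverseʳ : ∀ (a : Fin Q) → a +q (-q a) ≡ 0F
  -q-inverseʳ a = begin
    a +q (-q a)                           ≡⟨ cong (_+q (-q a)) (toℕ-mod-id a) ⟨
    (toℕ a mod Q) +q ((Q ∸ toℕ a) mod Q)  ≡⟨ mod-homo-+ (toℕ a) (Q ∸ toℕ a) ⟩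
    (toℕ a + (Q ∸ toℕ a)) mod Q           ≡⟨ cong (_mod Q) (m+[n∸m]≡n (<⇒≤ (toℕ<n a))) ⟩
    Q mod Q                               ≡⟨ mod-cong Q 0 (n%n≡0 Q) ⟩
    0F                                    ∎

  -q-inverseˡ : ∀ (a : Fin Q) → (-q a) +q a ≡ 0F
  -q-inverseˡ a = trans (+q-comm (-q a) a) (-q-inverseʳ a)

  +q-isAbelianGroup : IsAbelianGroup _≡_ _+q_ 0F (λ a → -q a)
  +q-isAbelianGroup = record
    { isGroup = record
      { isMonoid = record
        { isSemigroup = record
          { isMagma = record { isEquivalence = isEquivalence ; ∙-cong = cong₂ _+q_ }
          ; assoc = +q-assoc
          }
        ; identity = +q-identityˡ , +q-identityʳ
        }
      ; inverse = -q-inverseˡ , -q-inverseʳ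
      ; ⁻¹-cong = cong (λ a → -q a)
      }
    ; comm = +q-comm
    }

  +q-abelianGroup : AbelianGroup 0ℓ 0ℓ
  +q-abelianGroup = record { isAbelianGroup = +q-isAbelianGroup }

  open AbelianGroup +q-abelianGroup public using (commutativeSemigroup)
  open import Algebra.Properties.AbelianGroup +q-abelianGroup public
    using (//-rightDividesˡ; xyx⁻¹≈y; ⁻¹-involutive; x∙y⁻¹≈ε⇒x≈y; quasigroup)
  open import Algebra.Properties.Quasigroup quasigroup public using (cancelˡ; cancelʳ)
  open import Algebra.Properties.CommutativeSemigroup commutativeSemigroup public using (xy∙z≈xz∙y)

  ·q-homo-+ : ∀ j k (a : Fin Q) → (j + k) ·q a ≡ (j ·q a) +q (k ·q a)
  ·q-homo-+ j k a = trans (cong (_mod Q) (*-distribʳ-+ (toℕ a) j k)) (sym (mod-homo-+ (j * toℕ a) (k * toℕ a)))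

  ·q-suc : ∀ k (a : Fin Q) → suc k ·q a ≡ a +q (k ·q a)
  ·q-suc k a = trans (sym (mod-homo-+ (toℕ a) (k * toℕ a))) (cong (_+q (k ·q a)) (toℕ-mod-id a))

module Order {p : ℕ} {w : Fin (suc p)} {h : ℕ} (ord : AddOrder w h) where
  open ZMod p

  instance
    h≢0 : NonZero h
    h≢0 = >-nonZero (proj₁ ord)

  order-annihilates : h ·q w ≡ 0F
  order-annihilates = toℕ-injective (proj₁ (proj₂ ord))

  order-minimal : ∀ k → 0 < k → k ·q w ≡ 0F → h ≤ k
  order-minimal k k>0 kw≡0 = proj₂ (proj₂ ord) k k>0 (cong toℕ kw≡0)

  q∣h*w : Q ∣ h * toℕ w
  q∣h*w = m%n≡0⇒n∣m (h * toℕ w) Q (trans (sym (toℕ-mod (h * toℕ w))) (cong toℕ order-annihilates))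

  ·q-mod-order : ∀ k → (k % h) ·q w ≡ k ·q w
  ·q-mod-order k = mod-cong (k % h * a) (k * a) (begin
    (k % h * a) % Q                    ≡⟨ %-remove-+ʳ (k % h * a) (∣n⇒∣m*n (k / h) q∣h*w) ⟨
    (k % h * a + k / h * (h * a)) % Q  ≡⟨ cong (_% Q) (collect (k % h) (k / h) h a) ⟩
    ((k % h + k / h * h) * a) % Q      ≡⟨ cong (λ x → (x * a) % Q) (m≡m%n+[m/n]*n k h) ⟨
    (k * a) % Q                        ∎)
    where
    a = toℕ w
    collect : ∀ x y h a → x * a + y * (h * a) ≡ (x + y * h) * a
    collect = solve-∀

  order-∣ : ∀ {k} → k ·q w ≡ 0F → h ∣ k
  order-∣ {k} kw≡0 = least-positive-∣ order-minimal (trans (·q-mod-order k) kw≡0)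

  order-∣-q : h ∣ Q
  order-∣-q = order-∣ (mod-cong (Q * toℕ w) 0 (trans (cong (_% Q) (*-comm Q (toℕ w))) (m*n%n≡0 (toℕ w) Q)))

  ·q-≡⇒[b∸a]·q≡0 : ∀ {a b} → a ≤ b → a ·q w ≡ b ·q w → (b ∸ a) ·q w ≡ 0F
  ·q-≡⇒[b∸a]·q≡0 {a} {b} a≤b aw≡bw = cancelˡ (a ·q w) _ _ (begin
    (a ·q w) +q ((b ∸ a) ·q w)  ≡⟨ ·q-homo-+ a (b ∸ a) w ⟨
    (a + (b ∸ a)) ·q w          ≡⟨ cong (_·q w) (m+[n∸m]≡n a≤b) ⟩
    b ·q w                      ≡⟨ aw≡bw ⟨
    a ·q w                      ≡⟨ +q-identityʳ (a ·q w) ⟨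
    (a ·q w) +q 0F              ∎)

  ·q-≡⇒≡[mod] : ∀ {a b} → a ·q w ≡ b ·q w → a ≡ b [mod h ]
  ·q-≡⇒≡[mod] {a} {b} aw≡bw with ≤-total a b
  ... | inj₁ a≤b = ∣∸⇒≡[mod] a≤b (order-∣ (·q-≡⇒[b∸a]·q≡0 a≤b aw≡bw))
  ... | inj₂ b≤a = ≡[mod]-sym (∣∸⇒≡[mod] b≤a (order-∣ (·q-≡⇒[b∸a]·q≡0 b≤a (sym aw≡bw))))

  ·q-injective-below-order : ∀ {a b} → a < h → b < h → a ·q w ≡ b ·q w → a ≡ b
  ·q-injective-below-order a<h b<h aw≡bw = ≡[mod]∧<⇒≡ (·q-≡⇒≡[mod] aw≡bw) a<h b<h

-- Since r ∣ w, reduction mod r is constant on each coset ι ℓ + ⟨w⟩, which separates the cosets;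
-- as q = r h, counting shows that they cover ℤ_q.
module Cosets {p : ℕ} {w : Fin (suc p)} {h : ℕ} (ord : AddOrder w h) {r : ℕ} (q≡r*h : suc p ≡ r * h) where
  open ZMod p
  open Order ord

  instance
    r≢0 : NonZero r
    r≢0 = m*n≢0⇒m≢0 r {{subst NonZero q≡r*h _}}

  r∣q : r ∣ Q
  r∣q = divides h (trans q≡r*h (*-comm r h))

  r∣w : r ∣ toℕ w
  r∣w = *-cancelʳ-∣ h (subst₂ _∣_ q≡r*h (*-comm h (toℕ w)) q∣h*w)

  r∣·q : ∀ k → r ∣ toℕ (k ·q w)
  r∣·q k = subst (r ∣_) (sym (toℕ-mod (k * toℕ w))) (%-presˡ-∣ (∣n⇒∣m*n k r∣w) r∣q)

  ι : Fin r → Fin Q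
  ι ℓ = toℕ ℓ mod Q

  coset-index : ∀ ℓ k → toℕ (ι ℓ +q (k ·q w)) % r ≡ toℕ ℓ
  coset-index ℓ k = begin
    toℕ (ι ℓ +q (k ·q w)) % r              ≡⟨ cong (_% r) (toℕ-+q (ι ℓ) (k ·q w)) ⟩
    (toℕ (ι ℓ) + toℕ (k ·q w)) % Q % r     ≡⟨ m∣n⇒o%n%m≡o%m r Q _ r∣q ⟩
    (toℕ (ι ℓ) + toℕ (k ·q w)) % r         ≡⟨ %-remove-+ʳ (toℕ (ι ℓ)) (r∣·q k) ⟩
    toℕ (ι ℓ) % r                          ≡⟨ cong (_% r) (toℕ-mod (toℕ ℓ)) ⟩
    toℕ ℓ % Q % r                          ≡⟨ m∣n⇒o%n%m≡o%m r Q (toℕ ℓ) r∣q ⟩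
    toℕ ℓ % r                              ≡⟨ m<n⇒m%n≡m (toℕ<n ℓ) ⟩
    toℕ ℓ                                  ∎

  coset-injectiveˡ : ∀ {ℓ ℓ′ j k} → ι ℓ +q (j ·q w) ≡ ι ℓ′ +q (k ·q w) → ℓ ≡ ℓ′
  coset-injectiveˡ {ℓ} {ℓ′} {j} {k} e = toℕ-injective (begin
    toℕ ℓ                      ≡⟨ coset-index ℓ j ⟨
    toℕ (ι ℓ +q (j ·q w)) % r  ≡⟨ cong (λ c → toℕ c % r) e ⟩
    toℕ (ι ℓ′ +q (k ·q w)) % r ≡⟨ coset-index ℓ′ k ⟩
    toℕ ℓ′                     ∎)

  coset-injective : ∀ {ℓ ℓ′ j k} → j < h → k < h → ι ℓ +q (j ·q w) ≡ ι ℓ′ +q (k ·q w) → ℓ ≡ ℓ′ × j ≡ k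
  coset-injective {ℓ} {ℓ′} {j} {k} j<h k<h e with refl ← coset-injectiveˡ {ℓ} {ℓ′} {j} {k} e =
    refl , ·q-injective-below-order j<h k<h (cancelˡ (ι ℓ) (j ·q w) (k ·q w) e)

  coset-surjective : ∀ c → ∃ λ ℓ → ∃ λ k → k < h × c ≡ ι ℓ +q (k ·q w)
  coset-surjective c =
    let x , coset[x]≡c = injective⇒strictlySurjective (sym q≡r*h) coset-injective′ c
        ℓ , k = remQuot {r} h x
    in ℓ , toℕ k , toℕ<n k , sym coset[x]≡c
    where
    coset : Fin (r * h) → Fin Q
    coset x = let ℓ , k = remQuot {r} h x in ι ℓ +q (toℕ k ·q w)
    coset-injective′ : Injective _≡_ _≡_ coset
    coset-injective′ {x} {y} e
      with ℓ≡ℓ′ , k≡k′ ← coset-injective (toℕ<n (proj₂ (remQuot {r} h x))) (toℕ<n (proj₂ (remQuot {r} h y))) e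
      = begin
      x                                 ≡⟨ combine-remQuot {r} h x ⟨
      uncurry combine (remQuot {r} h x) ≡⟨ cong (uncurry combine) (cong₂ _,_ ℓ≡ℓ′ (toℕ-injective k≡k′)) ⟩
      uncurry combine (remQuot {r} h y) ≡⟨ combine-remQuot {r} h y ⟩
      y                                 ∎

module Antiderivative {p : ℕ} (s : Seq (suc p)) where
  open ZMod p

  DEq⇒step : ∀ {t} → DEq t s → ∀ i → t (suc i) ≡ t i +q s i
  DEq⇒step {t} Dt i = begin
    t (suc i)                    ≡⟨ //-rightDividesˡ (t i) (t (suc i)) ⟨
    (t (suc i) -q t i) +q t i    ≡⟨ cong (_+q t i) (Dt i) ⟩
    s i +q t i                   ≡⟨ +q-comm (s i) (t i) ⟩
    t i +q s i                   ∎

  step⇒DEq : ∀ {t} → (∀ i → t (suc i) ≡ t i +q s i) → DEq t s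
  step⇒DEq {t} step i = trans (cong (_-q t i) (step i)) (xyx⁻¹≈y (t i) (s i))

  wq-DEq : DEq (wq s) s
  wq-DEq = step⇒DEq {wq s} (λ i → refl)

  DEq-translate : ∀ {t} c → DEq t s → DEq (λ i → c +q t i) s
  DEq-translate {t} c Dt = step⇒DEq {λ i → c +q t i} λ i →
    trans (cong (c +q_) (DEq⇒step {t} Dt i)) (sym (+q-assoc c (t i) (s i)))

  DEq⇒≡+wq : ∀ {t} → DEq t s → ∀ i → t i ≡ t 0 +q wq s i
  DEq⇒≡+wq {t} Dt zero    = sym (+q-identityʳ (t 0))
  DEq⇒≡+wq {t} Dt (suc i) = begin
    t (suc i)                   ≡⟨ DEq⇒step {t} Dt i ⟩
    t i +q s i                  ≡⟨ cong (_+q s i) (DEq⇒≡+wq {t} Dt i) ⟩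
    (t 0 +q wq s i) +q s i      ≡⟨ +q-assoc (t 0) (wq s i) (s i) ⟩
    t 0 +q (wq s i +q s i)      ∎

  DEq-hasPeriod : ∀ {t k} → DEq t s → HasPeriod t k → HasPeriod s k
  DEq-hasPeriod {t} {k} Dt perₜ i = begin
    s (i + k)                          ≡⟨ Dt (i + k) ⟨
    t (suc i + k) -q t (i + k)         ≡⟨ cong₂ _-q_ (perₜ (suc i)) (perₜ i) ⟩
    t (suc i) -q t i                   ≡⟨ Dt i ⟩
    s i                                ∎

  module _ {m : ℕ} (perₛ : HasPeriod s m) where

    wq-+period : ∀ i → wq s (i + m) ≡ wq s i +q wq s m
    wq-+period zero    = sym (+q-identityˡ (wq s m))
    wq-+period (suc i) = begin
      wq s (i + m) +q s (i + m)            ≡⟨ cong₂ _+q_ (wq-+period i) (perₛ i) ⟩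
      (wq s i +q wq s m) +q s i            ≡⟨ xy∙z≈xz∙y (wq s i) (wq s m) (s i) ⟩
      (wq s i +q s i) +q wq s m            ∎

    DEq-+period : ∀ {t} → DEq t s → ∀ i → t (i + m) ≡ t i +q wq s m
    DEq-+period {t} Dt i = begin
      t (i + m)                            ≡⟨ DEq⇒≡+wq {t} Dt (i + m) ⟩
      t 0 +q wq s (i + m)                  ≡⟨ cong (t 0 +q_) (wq-+period i) ⟩
      t 0 +q (wq s i +q wq s m)            ≡⟨ +q-assoc (t 0) (wq s i) (wq s m) ⟨
      (t 0 +q wq s i) +q wq s m            ≡⟨ cong (_+q wq s m) (DEq⇒≡+wq {t} Dt i) ⟨
      t i +q wq s m                        ∎

    DEq-+*period : ∀ {t} → DEq t s → ∀ k i → t (i + k * m) ≡ t i +q (k ·q wq s m)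
    DEq-+*period {t} Dt zero    i = trans (cong t (+-identityʳ i)) (sym (+q-identityʳ (t i)))
    DEq-+*period {t} Dt (suc k) i = begin
      t (i + (m + k * m))                  ≡⟨ cong t (+-assoc i m (k * m)) ⟨
      t (i + m + k * m)                    ≡⟨ DEq-+*period {t} Dt k (i + m) ⟩
      t (i + m) +q (k ·q wq s m)           ≡⟨ cong (_+q (k ·q wq s m)) (DEq-+period {t} Dt i) ⟩
      (t i +q wq s m) +q (k ·q wq s m)     ≡⟨ +q-assoc (t i) (wq s m) (k ·q wq s m) ⟩
      t i +q (wq s m +q (k ·q wq s m))     ≡⟨ cong (t i +q_) (·q-suc k (wq s m)) ⟨
      t i +q (suc k ·q wq s m)             ∎

  DEq-window : ∀ {n t t′ i j} → DEq t s → DEq t′ s →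
             window (suc n) t i ≡ window (suc n) t′ j → window n s i ≡ window n s j
  DEq-window {n} {t} {t′} {i} {j} Dt Dt′ e = window-≡⇐ s s i j λ {x} x<n → begin
    s (i + x)                        ≡⟨ Dt (i + x) ⟨
    t (suc (i + x)) -q t (i + x)     ≡⟨ cong₂ _-q_ (next x<n) (t≡t′ (m<n⇒m<1+n x<n)) ⟩
    t′ (suc (j + x)) -q t′ (j + x)   ≡⟨ Dt′ (j + x) ⟩
    s (j + x)                        ∎
    where
    t≡t′ = window-≡⇒ t t′ i j e
    next : ∀ {x} → x < n → t (suc (i + x)) ≡ t′ (suc (j + x))
    next {x} x<n = begin
      t (suc (i + x))   ≡⟨ cong t (+-suc i x) ⟨
      t (i + suc x)     ≡⟨ t≡t′ (s<s x<n) ⟩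
      t′ (j + suc x)    ≡⟨ cong t′ (+-suc j x) ⟩
      t′ (suc (j + x))  ∎

  DEq-negRev-window : ∀ {n t t′ i j} → DEq t s → DEq t′ s →
                    window (suc n) t i ≡ negRev (window (suc n) t′ j) → window n s i ≡ reverse (window n s j)
  DEq-negRev-window {n} {t} {t′} {i} {j} Dt Dt′ e = window-≡-reverse⇐ s s i j λ {x} x<n →
    let u = j + (n ∸ suc x) in begin
    s (i + x)                           ≡⟨ Dt (i + x) ⟨
    t (suc (i + x)) -q t (i + x)        ≡⟨ cong₂ _-q_ (next x<n) (here x<n) ⟩
    (-q t′ u) -q (-q t′ (suc u))        ≡⟨ cong ((-q t′ u) +q_) (⁻¹-involutive (t′ (suc u))) ⟩
    (-q t′ u) +q t′ (suc u)             ≡⟨ +q-comm (-q t′ u) (t′ (suc u)) ⟩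
    t′ (suc u) -q t′ u                  ≡⟨ Dt′ u ⟩
    s u                                 ∎
    where
    t≡-t′ = window-≡-negRev⇒ t t′ i j e
    next : ∀ {x} → x < n → t (suc (i + x)) ≡ -q t′ (j + (n ∸ suc x))
    next {x} x<n = trans (cong t (sym (+-suc i x))) (t≡-t′ (s<s x<n))
    here : ∀ {x} → x < n → t (i + x) ≡ -q t′ (suc (j + (n ∸ suc x)))
    here {x} x<n = begin
      t (i + x)                        ≡⟨ t≡-t′ (m<n⇒m<1+n x<n) ⟩
      -q t′ (j + (n ∸ x))              ≡⟨ cong (λ y → -q t′ (j + y)) (+-∸-assoc 1 x<n) ⟩
      -q t′ (j + suc (n ∸ suc x))      ≡⟨ cong (λ y → -q t′ y) (+-suc j (n ∸ suc x)) ⟩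
      -q t′ (suc (j + (n ∸ suc x)))    ∎

  DEq⇒no-negRev-window : ∀ {n t t′} → (∀ i j → window n s i ≢ reverse (window n s j)) →
                         DEq t s → DEq t′ s → ∀ i j → window (suc n) t i ≢ negRev (window (suc n) t′ j)
  DEq⇒no-negRev-window {t = t} {t′} orₛ Dt Dt′ i j e = orₛ i j (DEq-negRev-window {t = t} {t′} Dt Dt′ e)

module PeriodicAntiderivative {p : ℕ} {s : Seq (suc p)} {m : ℕ} (lp : LeastPeriod s m) {h : ℕ} (ord : AddOrder (wq s m) h) where
  open ZMod p
  open Antiderivative s
  open Order ord

  private
    W = wq s m
    perₛ = proj₁ (proj₂ lp)
    instance
      m≢0 : NonZero m
      m≢0 = >-nonZero (proj₁ lp)

  DEq⇒leastPeriod : ∀ {t} → DEq t s → LeastPeriod t (h * m)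
  DEq⇒leastPeriod {t} Dt = >-nonZero⁻¹ (h * m) {{m*n≢0 h m}} , perₜ , least
    where
    perₜ : HasPeriod t (h * m)
    perₜ i = begin
      t (i + h * m)      ≡⟨ DEq-+*period perₛ {t} Dt h i ⟩
      t i +q (h ·q W)    ≡⟨ cong (t i +q_) order-annihilates ⟩
      t i +q 0F          ≡⟨ +q-identityʳ (t i) ⟩
      t i                ∎
    least : ∀ k → 0 < k → HasPeriod t k → h * m ≤ k
    least k k>0 perₖ with divides c k≡c*m ← leastPeriod-∣ lp (DEq-hasPeriod {t} Dt perₖ) =
      subst (h * m ≤_) (sym k≡c*m) (*-monoˡ-≤ m (∣⇒≤ {{c≢0}} (order-∣ cW≡0)))
      where
      c≢0 : NonZero c
      c≢0 = m*n≢0⇒m≢0 c {{subst NonZero k≡c*m (>-nonZero k>0)}}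
      cW≡0 : c ·q W ≡ 0F
      cW≡0 = cancelˡ (t 0) _ _ (begin
        t 0 +q (c ·q W)  ≡⟨ DEq-+*period perₛ {t} Dt c 0 ⟨
        t (c * m)        ≡⟨ cong t k≡c*m ⟨
        t k              ≡⟨ perₖ 0 ⟩
        t 0              ≡⟨ +q-identityʳ (t 0) ⟨
        t 0 +q 0F        ∎)

  DEq-window-≡⇒ : ∀ {n t t′ i j} → NWindow n s → DEq t s → DEq t′ s →
                 window (suc n) t i ≡ window (suc n) t′ j →
                 ∃₂ λ a b → i + a * m ≡ j + b * m × t j +q (b ·q W) ≡ t′ j +q (a ·q W)
  DEq-window-≡⇒ {n} {t} {t′} {i} {j} nwₛ Dt Dt′ e =
    let a , b , i+am≡j+bm = nwₛ m lp i j (DEq-window {t = t} {t′} Dt Dt′ e)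
    in a , b , i+am≡j+bm , (begin
      t j +q (b ·q W)    ≡⟨ DEq-+*period perₛ {t} Dt b j ⟨
      t (j + b * m)      ≡⟨ cong t i+am≡j+bm ⟨
      t (i + a * m)      ≡⟨ DEq-+*period perₛ {t} Dt a i ⟩
      t i +q (a ·q W)    ≡⟨ cong (_+q (a ·q W)) tᵢ≡t′ⱼ ⟩
      t′ j +q (a ·q W)   ∎)
    where
    tᵢ≡t′ⱼ : t i ≡ t′ j
    tᵢ≡t′ⱼ = begin
      t i         ≡⟨ cong t (+-identityʳ i) ⟨
      t (i + 0)   ≡⟨ window-≡⇒ t t′ i j e z<s ⟩
      t′ (j + 0)  ≡⟨ cong t′ (+-identityʳ j) ⟩
      t′ j        ∎

  DEq⇒nWindow : ∀ {n t} → NWindow n s → DEq t s → NWindow (suc n) t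
  DEq⇒nWindow {t = t} nwₛ Dt m′ lpₜ i j e =
    let a , b , i+am≡j+bm , bW≡aW = DEq-window-≡⇒ {t = t} {t} nwₛ Dt Dt e
    in subst (λ x → i ≡ j [mod x ]) (leastPeriod-unique (DEq⇒leastPeriod {t} Dt) lpₜ)
         (≡[mod]-scale {i} {j} {a} {b} {m} {h} i+am≡j+bm
           (≡[mod]-sym (·q-≡⇒≡[mod] (cancelˡ (t j) (b ·q W) (a ·q W) bW≡aW))))

module Classification {p : ℕ} {s : Seq (suc p)} {m : ℕ} (lp : LeastPeriod s m) {n : ℕ} (orₛ : Orientable n s)
                      {h : ℕ} (ord : AddOrder (wq s m) h) {r : ℕ} (q≡r*h : suc p ≡ r * h) where
  open ZMod p
  open Antiderivative s
  open Order ord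
  open Cosets ord {r} q≡r*h
  open PeriodicAntiderivative lp ord

  private
    W = wq s m
    perₛ = proj₁ (proj₂ lp)

  T : Fin r → Seq (suc p)
  T ℓ i = ι ℓ +q wq s i

  T-DEq : ∀ ℓ → DEq (T ℓ) s
  T-DEq ℓ = DEq-translate (ι ℓ) wq-DEq

  T-negOrientable : ∀ ℓ → NegOrientable (suc n) (T ℓ)
  T-negOrientable ℓ = DEq⇒nWindow {t = T ℓ} (proj₁ orₛ) (T-DEq ℓ)
                    , DEq⇒no-negRev-window {t = T ℓ} {T ℓ} (proj₂ orₛ) (T-DEq ℓ) (T-DEq ℓ)

  T-disjoint : ∀ ℓ ℓ′ → ℓ ≢ ℓ′ → Disjoint (suc n) (T ℓ) (T ℓ′)
  T-disjoint ℓ ℓ′ ℓ≢ℓ′ i j e =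
    let a , b , _ , Tj+bW≡T′j+aW = DEq-window-≡⇒ {t = T ℓ} {T ℓ′} {i} {j} (proj₁ orₛ) (T-DEq ℓ) (T-DEq ℓ′) e
    in ℓ≢ℓ′ (coset-injectiveˡ {j = b} {k = a} (cancelʳ (wq s j) _ _ (begin
      (ι ℓ +q (b ·q W)) +q wq s j    ≡⟨ xy∙z≈xz∙y (ι ℓ) (b ·q W) (wq s j) ⟩
      T ℓ j +q (b ·q W)              ≡⟨ Tj+bW≡T′j+aW ⟩
      T ℓ′ j +q (a ·q W)             ≡⟨ xy∙z≈xz∙y (ι ℓ′) (wq s j) (a ·q W) ⟩
      (ι ℓ′ +q (a ·q W)) +q wq s j   ∎)))

  T-noDisjoint : ∀ ℓ ℓ′ → ℓ ≢ ℓ′ → NoDisjoint (suc n) (T ℓ) (T ℓ′)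
  T-noDisjoint ℓ ℓ′ ℓ≢ℓ′ = T-disjoint ℓ ℓ′ ℓ≢ℓ′
                          , DEq⇒no-negRev-window {t = T ℓ} {T ℓ′} (proj₂ orₛ) (T-DEq ℓ) (T-DEq ℓ′)

  T-translate : ∀ ℓ ℓ′ → ℓ ≢ ℓ′ → Translate (T ℓ′) (T ℓ)
  T-translate ℓ ℓ′ ℓ≢ℓ′ = c , c≢0 , T′≡T+c
    where
    c = ι ℓ′ -q ι ℓ
    c≢0 : toℕ c ≢ 0
    c≢0 c≡0 = ℓ≢ℓ′ (sym (coset-injectiveˡ {j = 0} {k = 0}
                (cong (_+q 0F) (x∙y⁻¹≈ε⇒x≈y (ι ℓ′) (ι ℓ) (toℕ-injective c≡0)))))
    T′≡T+c : ∀ i → T ℓ′ i ≡ T ℓ i +q c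
    T′≡T+c i = begin
      ι ℓ′ +q wq s i          ≡⟨ cong (_+q wq s i) (//-rightDividesˡ (ι ℓ) (ι ℓ′)) ⟨
      (c +q ι ℓ) +q wq s i    ≡⟨ cong (_+q wq s i) (+q-comm c (ι ℓ)) ⟩
      (ι ℓ +q c) +q wq s i    ≡⟨ xy∙z≈xz∙y (ι ℓ) c (wq s i) ⟩
      (ι ℓ +q wq s i) +q c    ∎

  T-leastPeriod : ∀ ℓ → LeastPeriod (T ℓ) (h * m)
  T-leastPeriod ℓ = DEq⇒leastPeriod {T ℓ} (T-DEq ℓ)

  D⁻¹-classification : ∀ t → InDInv t s ⇔ (∃ λ ℓ → ∃ λ k → k < h × (∀ i → t i ≡ T ℓ (i + k * m)))
  D⁻¹-classification t = mk⇔ to from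
    where
    to : InDInv t s → ∃ λ ℓ → ∃ λ k → k < h × (∀ i → t i ≡ T ℓ (i + k * m))
    to (_ , Dt) =
      let ℓ , k , k<h , t₀≡ι+kW = coset-surjective (t 0)
      in ℓ , k , k<h , λ i → begin
        t i                            ≡⟨ DEq⇒≡+wq {t} Dt i ⟩
        t 0 +q wq s i                  ≡⟨ cong (_+q wq s i) t₀≡ι+kW ⟩
        (ι ℓ +q (k ·q W)) +q wq s i    ≡⟨ xy∙z≈xz∙y (ι ℓ) (k ·q W) (wq s i) ⟩
        T ℓ i +q (k ·q W)              ≡⟨ DEq-+*period perₛ {T ℓ} (T-DEq ℓ) k i ⟨
        T ℓ (i + k * m)                ∎
    from : (∃ λ ℓ → ∃ λ k → k < h × (∀ i → t i ≡ T ℓ (i + k * m))) → InDInv t s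
    from (ℓ , k , _ , t≡T) = (h * m , proj₁ (T-leastPeriod ℓ) , perₜ) , Dt
      where
      per[T] : HasPeriod (T ℓ) (h * m)
      per[T] = proj₁ (proj₂ (T-leastPeriod ℓ))
      perₜ : HasPeriod t (h * m)
      perₜ i = begin
        t (i + h * m)              ≡⟨ t≡T (i + h * m) ⟩
        T ℓ (i + h * m + k * m)    ≡⟨ cong (T ℓ) (+-assoc i (h * m) (k * m)) ⟩
        T ℓ (i + (h * m + k * m))  ≡⟨ cong (λ x → T ℓ (i + x)) (+-comm (h * m) (k * m)) ⟩
        T ℓ (i + (k * m + h * m))  ≡⟨ cong (T ℓ) (+-assoc i (k * m) (h * m)) ⟨
        T ℓ (i + k * m + h * m)    ≡⟨ per[T] (i + k * m) ⟩
        T ℓ (i + k * m)            ≡⟨ t≡T i ⟨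
        t i                        ∎
      Dt : DEq t s
      Dt i = begin
        t (suc i) -q t i                           ≡⟨ cong₂ _-q_ (t≡T (suc i)) (t≡T i) ⟩
        T ℓ (suc i + k * m) -q T ℓ (i + k * m)     ≡⟨ T-DEq ℓ (i + k * m) ⟩
        s (i + k * m)                              ≡⟨ hasPeriod-* perₛ k i ⟩
        s i                                        ∎

theorem5 : (q n : ℕ) → 2 ≤ q → 1 ≤ n →
    (s : Seq q) (m : ℕ) → LeastPeriod s m → Orientable n s →
    (h : ℕ) → AddOrder (wq s m) h →
    ∃ λ r → r * h ≡ q ×
      (∃ λ (T : Fin r → Seq q) →
        (∀ ℓ → NegOrientable (1 + n) (T ℓ) × LeastPeriod (T ℓ) (h * m))
        × (∀ ℓ ℓ′ → ℓ ≢ ℓ′ → Translate (T ℓ′) (T ℓ) × NoDisjoint (1 + n) (T ℓ) (T ℓ′))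
        × (∀ (t : Seq q) → InDInv t s ⇔
             (∃ λ ℓ → ∃ λ k → k < h × (∀ i → t i ≡ T ℓ (i + k * m)))))
-- 2 ≤ q only serves to exclude q = 0.
theorem5 zero    _ () _ _ _ _ _ _ _
theorem5 (suc p) n _ _ s m lp orₛ h ord with divides r q≡r*h ← Order.order-∣-q ord =
  r , sym q≡r*h , T
  , (λ ℓ → T-negOrientable ℓ , T-leastPeriod ℓ)
  , (λ ℓ ℓ′ ℓ≢ℓ′ → T-translate ℓ ℓ′ ℓ≢ℓ′ , T-noDisjoint ℓ ℓ′ ℓ≢ℓ′)
  , D⁻¹-classification
  where open Classification lp orₛ ord {r} q≡r*h
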